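{- Let $1\le l\le r$ be integers, let $i_1,\dots,i_{k-1}\in\{l,\dots,r\}$, let $I\in\mathcal{L}_{l,r}$, and let $S\subseteq\{l,\dots,r\}$. Then $\mathcal{T}_{l,r}^{\{i_1\},\dots,\{i_{k-1}\},I}(-S)$ has a perfect matching if and only if $S=\{l,\dots,r\}\setminus\{i_1,\dots,i_{k-1},i'\}$ for some $i'\in I$ such that $i_1,\dots,i_{k-1},i'$ are distinct.
   Context: For integers $r\ge l\ge1$, the rooted tree $\mathcal{T}_{l,r}$ is defined recursively: if $l=r$ it consists only of a root labeled $\{l\}$; if $l<r$, it consists of a root labeled $\{l,\dots,r\}$ with a single (unlabeled) child vertex whose two children are the roots of $\mathcal{T}_{l,\lfloor (l+r)/2\rfloor}$ and $\mathcal{T}_{\lfloor (l+r)/2\rfloor+1,r}$. Every labeled vertex is labeled by the set of its descendant leaves; the leaves are the vertices labeled $\{i\}$. $\mathcal{L}_{l,r}$ is the set of labels of $\mathcal{T}_{l,r}$ (so $\mathcal{L}_{l,r}=\{\{l\}\}$ if $l=r$ and $\mathcal{L}_{l,r}=\{\{l,\dots,r\}\}\cup\mathcal{L}_{l,\lfloor (l+r)/2\rfloor}\cup\mathcal{L}_{\lfloor (l+r)/2\rfloor+1,r}$ otherwise). For $a_1,\dots,a_k\in\mathcal{L}_{l,r}$, $\mathcal{T}_{l,r}^{a_1,\dots,a_k}$ is $\mathcal{T}_{l,r}$ together with $k$ new "switch" vertices, the $t$-th of which is joined by a single edge to the vertex with label $a_t$. For $S\subseteq\{l,\dots,r\}$,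 $\mathcal{T}_{l,r}^{a_1,\dots,a_k}(-S)$ is this graph with the vertices labeled $\{i\}$, $i\in S$, removed. -}

module Defs where

open import Data.Nat using (ℕ; zero; suc; _+_; _≤_; _<_; _≡ᵇ_)
open import Data.Nat.DivMod using (_/_)
open import Data.Bool using (Bool; true; false; _∧_; not; T)
open import Data.Maybe using (Maybe; just; nothing)
open import Data.Product using (Σ; ∃; _×_; _,_)
open import Data.Sum using (_⊎_)
open import Data.Fin using (Fin; fromℕ)
open import Data.Vec.Functional using (insertAt)
open import Relation.Binary.PropositionalEquality using (_≡_)

mid : ℕ → ℕ → ℕ
mid l r = (l + r) / 2

-- A label {a,…,b} (an integer interval) is represented by the pair (a , b).
Label : Set
Label = ℕ × ℕ

_∈I_ : ℕ → Label → Set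
i ∈I (a , b) = a ≤ i × i ≤ b

-- Vertices of the rooted tree 𝒯_{l,r}:
--   root          : the root of 𝒯_{l,r} (labeled {l,…,r})
--   hub p         : the single unlabeled child of the root (only when l < r)
--   left  p v     : vertex v of the subtree 𝒯_{l,mid}
--   right p v     : vertex v of the subtree 𝒯_{mid+1,r}
data TV : ℕ → ℕ → Set where
  root  : ∀ {l r} → TV l r
  hub   : ∀ {l r} → .(l < r) → TV l r
  left  : ∀ {l r} → .(l < r) → TV l (mid l r) → TV l r
  right : ∀ {l r} → .(l < r) → TV (suc (mid l r)) r → TV l r

label : ∀ {l r} → TV l r → Maybe Label
label {l} {r} root = just (l , r)
label (hub _)     = nothing
label (left _ v)  = label v
label (right _ v) = label v

data TreeEdge : ∀ {l r} → TV l r → TV l r → Set where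
  root-hub  : ∀ {l r} .(p : l < r) → TreeEdge {l} {r} root (hub p)
  hub-left  : ∀ {l r} .(p : l < r) → TreeEdge {l} {r} (hub p) (left p root)
  hub-right : ∀ {l r} .(p : l < r) → TreeEdge {l} {r} (hub p) (right p root)
  in-left   : ∀ {l r} .(p : l < r) {u v : TV l (mid l r)} →
              TreeEdge u v → TreeEdge {l} {r} (left p u) (left p v)
  in-right  : ∀ {l r} .(p : l < r) {u v : TV (suc (mid l r)) r} →
              TreeEdge u v → TreeEdge {l} {r} (right p u) (right p v)

_∈L[_,_] : Label → ℕ → ℕ → Set
I ∈L[ l , r ] = Σ (TV l r) (λ v → label v ≡ just I)

removed : ∀ {l r} → (ℕ → Bool) → TV l r → Bool
removed S v with label v
... | just (a , b) = (a ≡ᵇ b) ∧ S a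
... | nothing      = false

record Graph : Set₁ where
  field
    V   : Set
    Adj : V → V → Set

record PerfectMatching (G : Graph) : Set₁ where
  open Graph G
  field
    M       : V → V → Set
    M⊆Adj   : ∀ {u v} → M u v → Adj u v
    M-sym   : ∀ {u v} → M u v → M v u
    partner : ∀ u → Σ V (λ v → M u v)
    unique  : ∀ {u v w} → M u v → M u w → v ≡ w

data SV (l r k : ℕ) (S : ℕ → Bool) : Set where
  tree   : (v : TV l r) → T (not (removed S v)) → SV l r k S
  switch : Fin k → SV l r k S

data SAdj (l r k : ℕ) (a : Fin k → Label) (S : ℕ → Bool) :
          SV l r k S → SV l r k S → Set where
  tree-edge   : ∀ {u v} {pu pv} → TreeEdge u v →
                SAdj l r k a S (tree u pu) (tree v pv)
  switch-edge : ∀ {t v} {pv} → label v ≡ just (a t) →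
                SAdj l r k a S (switch t) (tree v pv)

Tsw : (l r k : ℕ) → (Fin k → Label) → (ℕ → Bool) → Graph
Tsw l r k a S = record
  { V   = SV l r k S
  ; Adj = λ u v → SAdj l r k a S u v ⊎ SAdj l r k a S v u }

snoc : ∀ {A : Set} {n} → (Fin n → A) → A → Fin (suc n) → A
snoc {n = n} xs y = insertAt xs (fromℕ n) y

switchLabels : ∀ {n} → (Fin n → ℕ) → Label → Fin (suc n) → Label
switchLabels is I = snoc (λ t → is t , is t) I

{-# OPTIONS --safe #-}
-- A perfect matching pairs every switch with the unique vertex carrying its label, so the labels
-- {i₁},…,{i_{k-1}},I sit on distinct vertices, and it pairs every hub with its parent or one of its
-- two children.  Call a kept leaf free if no switch hangs on it.  Going down the tree, the root of
-- a subtree is matched with its own hub, with the hub above it, or (only when it is the vertex w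
-- labelled I) with the switch of I; by induction a subtree then has exactly one free leaf, lying
-- in I, if it contains w, exactly one if its root is matched upwards, and none otherwise.  For the
-- whole tree this is the leaf i′.
-- Conversely, match every root with its hub and every kept leaf {i_t} with its switch, then shift
-- along the path from w down to the leaf {i′}: w takes the switch of I, each hub on the path takes
-- its child towards i′, and the leaf i′ takes the hub above it.

module Submission where

open import Defs
open import Data.Nat using (ℕ; suc; _+_; _*_; _∸_; _≤_; _<_; _≡ᵇ_; s≤s; _≤?_; _<?_; _≟_)
open import Data.Nat.Properties
open import Data.Nat.DivMod using (_/_; m<n*o⇒m/o<n; m*n/n≡m; /-monoˡ-≤)
open import Data.Nat.Induction using (<-wellFounded)
open import Induction.WellFounded using (Acc; acc)
open import Data.Bool using (Bool; true; false; _∧_; not; T)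
open import Data.Bool.Properties using (T-irrelevant; T-≡; T-not-≡)
open import Data.Empty using (⊥; ⊥-elim)
open import Data.Unit using (⊤)
open import Data.Maybe using (just; nothing)
open import Data.Maybe.Properties using (just-injective)
open import Data.Product using (Σ; ∃; _×_; _,_; proj₁; proj₂)
open import Data.Sum as Sum using (_⊎_; inj₁; inj₂; [_,_]′)
open import Data.Fin as Fin using (Fin; fromℕ; punchIn)
open import Data.Fin.Properties using (punchIn-injective; punchInᵢ≢i; punchIn-punchOut; any?)
open import Data.Product.Properties using (≡-dec)
open import Data.Vec.Functional.Properties using (insertAt-lookup; insertAt-punchIn)
open import Function.Base using (_∘_)
open import Function.Bundles using (_⇔_; mk⇔; Equivalence)
open import Function.Definitions using (Injective)
open import Relation.Nullary using (¬_; Dec; yes; no)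
open import Relation.Nullary.Decidable using (recompute)
open import Relation.Binary.PropositionalEquality

<-recompute : ∀ {m n} → .(m < n) → m < n
<-recompute {m} {n} m<n = recompute (m <? n) m<n

m*2≡m+m : ∀ m → m * 2 ≡ m + m
m*2≡m+m m = trans (*-comm m 2) (cong (m +_) (+-identityʳ m))

m<n⇒m≤mid : ∀ {m n} → m < n → m ≤ mid m n
m<n⇒m≤mid {m} {n} m<n = begin
  m            ≡⟨ m*n/n≡m m 2 ⟨
  m * 2 / 2    ≡⟨ cong (_/ 2) (m*2≡m+m m) ⟩
  (m + m) / 2  ≤⟨ /-monoˡ-≤ 2 (+-monoʳ-≤ m (<⇒≤ m<n)) ⟩
  mid m n      ∎
  where open ≤-Reasoning

m<n⇒mid<n : ∀ {m n} → m < n → mid m n < n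
m<n⇒mid<n {m} {n} m<n = m<n*o⇒m/o<n (begin-strict
  m + n  <⟨ +-monoˡ-< n m<n ⟩
  n + n  ≡⟨ m*2≡m+m n ⟨
  n * 2  ∎)
  where open ≤-Reasoning

∈I-split : ∀ {x a b} m → x ∈I (a , b) → x ∈I (a , m) ⊎ x ∈I (suc m , b)
∈I-split {x} m (a≤x , x≤b) with x ≤? m
... | yes x≤m = inj₁ (a≤x , x≤m)
... | no x≰m  = inj₂ (≰⇒> x≰m , x≤b)

NoneIn : (ℕ → Set) → Label → Set
NoneIn P J = ∀ x → x ∈I J → ¬ P x

UniqueIn : (ℕ → Set) → Label → Set
UniqueIn P J = Σ ℕ λ i → i ∈I J × P i × (∀ x → x ∈I J → P x → x ≡ i)

module _ {P : ℕ → Set} {a m b : ℕ} where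

  noneIn-++ : NoneIn P (a , m) → NoneIn P (suc m , b) → NoneIn P (a , b)
  noneIn-++ none₁ none₂ x x∈ with ∈I-split m x∈
  ... | inj₁ x∈₁ = none₁ x x∈₁
  ... | inj₂ x∈₂ = none₂ x x∈₂

  uniqueIn-++-noneIn : m ≤ b → UniqueIn P (a , m) → NoneIn P (suc m , b) → UniqueIn P (a , b)
  uniqueIn-++-noneIn m≤b (i , (a≤i , i≤m) , Pi , unique) none =
    i , (a≤i , ≤-trans i≤m m≤b) , Pi ,
    λ x x∈ Px → [ (λ x∈₁ → unique x x∈₁ Px) , (λ x∈₂ → ⊥-elim (none x x∈₂ Px)) ]′ (∈I-split m x∈)

  noneIn-++-uniqueIn : a ≤ m → NoneIn P (a , m) → UniqueIn P (suc m , b) → UniqueIn P (a , b)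
  noneIn-++-uniqueIn a≤m none (i , (m<i , i≤b) , Pi , unique) =
    i , (≤-trans a≤m (<⇒≤ m<i) , i≤b) , Pi ,
    λ x x∈ Px → [ (λ x∈₁ → ⊥-elim (none x x∈₁ Px)) , (λ x∈₂ → unique x x∈₂ Px) ]′ (∈I-split m x∈)

true-false-apart : ∀ {A : Set} (f : A → Bool) {x y} → f x ≡ true → f y ≡ false → x ≢ y
true-false-apart f fx≡true fy≡false refl with trans (sym fx≡true) fy≡false
... | ()

-- The switch of I is the last one, sI; the switch of {is t} is s[ t ].
sI : ∀ {n} → Fin (suc n)
sI {n} = fromℕ n

s[_] : ∀ {n} → Fin n → Fin (suc n)
s[_] {n} = punchIn (fromℕ n)

data SnocView (n : ℕ) : Fin (suc n) → Set where
  last : SnocView n sI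
  old  : (t : Fin n) → SnocView n s[ t ]

snocView : ∀ {n} (t : Fin (suc n)) → SnocView n t
snocView {n} t with t Fin.≟ fromℕ n
... | yes refl   = last
... | no t≢last = subst (SnocView n) (punchIn-punchOut (t≢last ∘ sym)) (old _)

module _ {A : Set} {n : ℕ} (xs : Fin n → A) (y : A) where

  snoc-last : snoc xs y sI ≡ y
  snoc-last = insertAt-lookup xs (fromℕ n) y

  snoc-old : ∀ t → snoc xs y s[ t ] ≡ xs t
  snoc-old = insertAt-punchIn xs (fromℕ n) y

  snoc-injective : Injective _≡_ _≡_ xs → (∀ t → xs t ≢ y) → Injective _≡_ _≡_ (snoc xs y)
  snoc-injective xs-inj xs≢y {t₁} {t₂} eq with snocView t₁ | snocView t₂
  ... | last  | last  = refl
  ... | last  | old s = ⊥-elim (xs≢y s (trans (sym (snoc-old s)) (trans (sym eq) snoc-last)))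
  ... | old s | last  = ⊥-elim (xs≢y s (trans (sym (snoc-old s)) (trans eq snoc-last)))
  ... | old s | old s′ = cong s[_] (xs-inj (trans (sym (snoc-old s)) (trans eq (snoc-old s′))))

  snoc-injective⁻ : Injective _≡_ _≡_ (snoc xs y) → Injective _≡_ _≡_ xs × (∀ t → xs t ≢ y)
  snoc-injective⁻ inj =
    (λ {s} {s′} eq → punchIn-injective (fromℕ n) s s′ (inj (trans (snoc-old s) (trans eq (sym (snoc-old s′)))))) ,
    (λ s eq → punchInᵢ≢i (fromℕ n) s (inj (trans (snoc-old s) (trans eq (sym snoc-last)))))

  avoids-snoc : ∀ {x} → (∀ t → x ≢ xs t) → x ≢ y → ∀ t → x ≢ snoc xs y t
  avoids-snoc x∉xs x≢y t eq with snocView t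
  ... | last  = x≢y (trans eq snoc-last)
  ... | old s = x∉xs s (trans eq (snoc-old s))

  avoids-snoc⁻ : ∀ {x} → (∀ t → x ≢ snoc xs y t) → (∀ t → x ≢ xs t) × x ≢ y
  avoids-snoc⁻ x∉ = (λ s eq → x∉ _ (trans eq (sym (snoc-old s)))) , (λ eq → x∉ _ (trans eq (sym snoc-last)))

switchLabels-sI : ∀ {n} (is : Fin n → ℕ) I → switchLabels is I sI ≡ I
switchLabels-sI is = snoc-last (λ t → is t , is t)

switchLabels-s[] : ∀ {n} (is : Fin n → ℕ) I t → switchLabels is I s[ t ] ≡ (is t , is t)
switchLabels-s[] is = snoc-old (λ t → is t , is t)

data Bisection : ℕ → ℕ → Set where
  leaf : ∀ {a} → Bisection a a
  node : ∀ {a b} → a < b → Bisection a (mid a b) → Bisection (suc (mid a b)) b → Bisection a b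

bisection : ∀ {a b} → a ≤ b → Bisection a b
bisection a≤b = go a≤b (<-wellFounded _)
  where
  go : ∀ {a b} → a ≤ b → Acc _<_ (b ∸ a) → Bisection a b
  go a≤b (acc smaller) with m≤n⇒m<n∨m≡n a≤b
  ... | inj₂ refl = leaf
  ... | inj₁ a<b  = node a<b
    (go (m<n⇒m≤mid a<b) (smaller (∸-monoˡ-< (m<n⇒mid<n a<b) (m<n⇒m≤mid a<b))))
    (go (m<n⇒mid<n a<b) (smaller (∸-monoʳ-< (s≤s (m<n⇒m≤mid a<b)) (m<n⇒mid<n a<b))))

data PathTo (x : ℕ) : ℕ → ℕ → Set where
  here : PathTo x x x
  goL  : ∀ {a b} → .(a < b) → PathTo x a (mid a b) → PathTo x a b
  goR  : ∀ {a b} → .(a < b) → PathTo x (suc (mid a b)) b → PathTo x a b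

pathTo : ∀ {x a b} → Bisection a b → x ∈I (a , b) → PathTo x a b
pathTo leaf (a≤x , x≤a) rewrite ≤-antisym x≤a a≤x = here
pathTo {a = a} {b} (node a<b lower upper) x∈ with ∈I-split (mid a b) x∈
... | inj₁ x∈₁ = goL a<b (pathTo lower x∈₁)
... | inj₂ x∈₂ = goR a<b (pathTo upper x∈₂)

pathTo-bounds : ∀ {x a b} → PathTo x a b → x ∈I (a , b)
pathTo-bounds here = ≤-refl , ≤-refl
pathTo-bounds (goL a<b d) with pathTo-bounds d
... | a≤x , x≤m = a≤x , ≤-trans x≤m (<⇒≤ (m<n⇒mid<n (<-recompute a<b)))
pathTo-bounds (goR a<b d) with pathTo-bounds d
... | m<x , x≤b = ≤-trans (m<n⇒m≤mid (<-recompute a<b)) (<⇒≤ m<x) , x≤b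

endpoint : ∀ {x a b} → PathTo x a b → TV a b
endpoint here        = root
endpoint (goL a<b d) = left a<b (endpoint d)
endpoint (goR a<b d) = right a<b (endpoint d)

label-endpoint : ∀ {x a b} (d : PathTo x a b) → label (endpoint d) ≡ just (x , x)
label-endpoint here        = refl
label-endpoint (goL _ d) = label-endpoint d
label-endpoint (goR _ d) = label-endpoint d

label-bounds : ∀ {a b x y} (v : TV a b) → a ≤ b → label v ≡ just (x , y) → a ≤ x × x ≤ y × y ≤ b
label-bounds root       a≤b refl = ≤-refl , a≤b , ≤-refl
label-bounds (left a<b v) _ eq with label-bounds v (m<n⇒m≤mid (<-recompute a<b)) eq
... | a≤x , x≤y , y≤m = a≤x , x≤y , ≤-trans y≤m (<⇒≤ (m<n⇒mid<n (<-recompute a<b)))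
label-bounds (right a<b v) _ eq with label-bounds v (m<n⇒mid<n (<-recompute a<b)) eq
... | m<x , x≤y , y≤b = ≤-trans (m<n⇒m≤mid (<-recompute a<b)) (<⇒≤ m<x) , x≤y , y≤b

module _ {a b : ℕ} .(a<b : a < b) where

  private
    a≤mid = m<n⇒m≤mid (<-recompute a<b)
    mid<b = m<n⇒mid<n (<-recompute a<b)

  left-label≢root : (v : TV a (mid a b)) → label v ≢ just (a , b)
  left-label≢root v eq = <⇒≱ mid<b (proj₂ (proj₂ (label-bounds v a≤mid eq)))

  right-label≢root : (v : TV (suc (mid a b)) b) → label v ≢ just (a , b)
  right-label≢root v eq = <⇒≱ (proj₁ (label-bounds v mid<b eq)) a≤mid

  left-right-labels-differ : ∀ {J} (v : TV a (mid a b)) (v′ : TV (suc (mid a b)) b) → label v ≡ just J → label v′ ≢ just J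
  left-right-labels-differ v v′ eq eq′ with label-bounds v a≤mid eq | label-bounds v′ mid<b eq′
  ... | _ , x≤y , y≤mid | mid<x , _ = <⇒≱ mid<x (≤-trans x≤y y≤mid)

label-injective : ∀ {a b J} (v v′ : TV a b) → a ≤ b → label v ≡ just J → label v′ ≡ just J → v ≡ v′
label-injective root root _ _ _ = refl
label-injective (left a<b v) (left _ v′) _ eq eq′ =
  cong (left a<b) (label-injective v v′ (m<n⇒m≤mid (<-recompute a<b)) eq eq′)
label-injective (right a<b v) (right _ v′) _ eq eq′ =
  cong (right a<b) (label-injective v v′ (m<n⇒mid<n (<-recompute a<b)) eq eq′)
label-injective root          (left a<b v′)  _ refl eq′  = ⊥-elim (left-label≢root a<b v′ eq′)
label-injective (left a<b v)  root           _ eq   refl = ⊥-elim (left-label≢root a<b v eq)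
label-injective root          (right a<b v′) _ refl eq′  = ⊥-elim (right-label≢root a<b v′ eq′)
label-injective (right a<b v) root           _ eq   refl = ⊥-elim (right-label≢root a<b v eq)
label-injective (left a<b v)  (right _ v′)   _ eq   eq′  = ⊥-elim (left-right-labels-differ a<b v v′ eq eq′)
label-injective (right a<b v) (left _ v′)    _ eq   eq′  = ⊥-elim (left-right-labels-differ a<b v′ v eq′ eq)
label-injective (hub _)    _       _ () _
label-injective root       (hub _) _ _  ()
label-injective (left _ _)  (hub _) _ _ ()
label-injective (right _ _) (hub _) _ _ ()

module _ (S : ℕ → Bool) where

  Present : ∀ {a b} → TV a b → Set
  Present v = T (not (removed S v))

  present-by-label : ∀ {a b x y} (v : TV a b) → label v ≡ just (x , y) → (x ≡ y → S x ≡ false) → Present v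
  present-by-label {x = x} {y} v eq leaf-kept rewrite eq with x ≡ᵇ y in x≡ᵇy
  ... | false = _
  ... | true rewrite leaf-kept (≡ᵇ⇒≡ x y (Equivalence.from T-≡ x≡ᵇy)) = _

  present-unlabelled : ∀ {a b} (v : TV a b) → label v ≡ nothing → Present v
  present-unlabelled v eq rewrite eq = _

  present-leaf⁻ : ∀ {a b x} (v : TV a b) → label v ≡ just (x , x) → Present v → S x ≡ false
  present-leaf⁻ {x = x} v eq pv rewrite eq | Equivalence.to T-≡ (≡⇒≡ᵇ x x refl) = Equivalence.to T-not-≡ pv

  removed-left : ∀ {a b} .{a<b : a < b} (v : TV a (mid a b)) → removed S (left a<b v) ≡ removed S v
  removed-left v with label v
  ... | just _  = refl
  ... | nothing = refl

  removed-right : ∀ {a b} .{a<b : a < b} (v : TV (suc (mid a b)) b) → removed S (right a<b v) ≡ removed S v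
  removed-right v with label v
  ... | just _  = refl
  ... | nothing = refl

  present-left : ∀ {a b} .(a<b : a < b) (v : TV a (mid a b)) → Present v → Present (left a<b v)
  present-left {a} {b} a<b v = subst (T ∘ not) (sym (removed-left {a} {b} {a<b} v))

  present-left⁻ : ∀ {a b} .(a<b : a < b) (v : TV a (mid a b)) → Present (left a<b v) → Present v
  present-left⁻ {a} {b} a<b v = subst (T ∘ not) (removed-left {a} {b} {a<b} v)

  present-right : ∀ {a b} .(a<b : a < b) (v : TV (suc (mid a b)) b) → Present v → Present (right a<b v)
  present-right {a} {b} a<b v = subst (T ∘ not) (sym (removed-right {a} {b} {a<b} v))

  present-right⁻ : ∀ {a b} .(a<b : a < b) (v : TV (suc (mid a b)) b) → Present (right a<b v) → Present v
  present-right⁻ {a} {b} a<b v = subst (T ∘ not) (removed-right {a} {b} {a<b} v)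

-- The position of the subtree 𝒯_{a,b} inside 𝒯_{l,r}.
data Ctx (l r : ℕ) : ℕ → ℕ → Set where
  top : Ctx l r l r
  inL : ∀ {a b} → Ctx l r a b → .(a < b) → Ctx l r a (mid a b)
  inR : ∀ {a b} → Ctx l r a b → .(a < b) → Ctx l r (suc (mid a b)) b

module _ {l r : ℕ} where

  plug : ∀ {a b} → Ctx l r a b → TV a b → TV l r
  plug top       v = v
  plug (inL c p) v = plug c (left p v)
  plug (inR c p) v = plug c (right p v)

  label-plug : ∀ {a b} (c : Ctx l r a b) (v : TV a b) → label (plug c v) ≡ label v
  label-plug top       v = refl
  label-plug (inL c p) v = label-plug c (left p v)
  label-plug (inR c p) v = label-plug c (right p v)

  plug-injective : ∀ {a b} (c : Ctx l r a b) {v v′ : TV a b} → plug c v ≡ plug c v′ → v ≡ v′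
  plug-injective top       eq = eq
  plug-injective (inL c p) eq with plug-injective c eq
  ... | refl = refl
  plug-injective (inR c p) eq with plug-injective c eq
  ... | refl = refl

  ParentHub : ∀ {a b} → Ctx l r a b → TV l r → Set
  ParentHub top       y = ⊥
  ParentHub (inL c p) y = y ≡ plug c (hub p)
  ParentHub (inR c p) y = y ≡ plug c (hub p)

  parentHub-outside : ∀ {a b} (c : Ctx l r a b) {y : TV l r} → ParentHub c y → ∀ v → y ≢ plug c v
  parentHub-outside (inL c p) refl v eq with plug-injective c eq
  ... | ()
  parentHub-outside (inR c p) refl v eq with plug-injective c eq
  ... | ()

  edge-from-plug : ∀ {a b} (c : Ctx l r a b) {x : TV a b} {y : TV l r} → TreeEdge (plug c x) y →
                   Σ (TV a b) λ y′ → y ≡ plug c y′ × TreeEdge x y′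
  edge-from-plug top e = _ , refl , e
  edge-from-plug (inL c p) e with edge-from-plug c e
  ... | _ , refl , in-left _ e′ = _ , refl , e′
  edge-from-plug (inR c p) e with edge-from-plug c e
  ... | _ , refl , in-right _ e′ = _ , refl , e′

  edge-into-plug : ∀ {a b} (c : Ctx l r a b) {x : TV a b} {y : TV l r} → TreeEdge y (plug c x) →
                   (Σ (TV a b) λ y′ → y ≡ plug c y′ × TreeEdge y′ x) ⊎ (x ≡ root × ParentHub c y)
  edge-into-plug top e = inj₁ (_ , refl , e)
  edge-into-plug (inL c p) e with edge-into-plug c e
  ... | inj₁ (_ , refl , in-left _ e′) = inj₁ (_ , refl , e′)
  ... | inj₁ (_ , refl , hub-left _)   = inj₂ (refl , refl)
  ... | inj₂ (() , _)
  edge-into-plug (inR c p) e with edge-into-plug c e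
  ... | inj₁ (_ , refl , in-right _ e′) = inj₁ (_ , refl , e′)
  ... | inj₁ (_ , refl , hub-right _)   = inj₂ (refl , refl)
  ... | inj₂ (() , _)

module Forward {l r : ℕ} (l≤r : l ≤ r) {n : ℕ} (is : Fin n → ℕ) {I : Label}
               (w : TV l r) (label-w : label w ≡ just I) (S : ℕ → Bool)
               (PM : PerfectMatching (Tsw l r (suc n) (switchLabels is I) S)) where
  open PerfectMatching PM

  _~_ : TV l r → TV l r → Set
  x ~ y = Σ (Present S x) λ px → Σ (Present S y) λ py → M (tree x px) (tree y py)

  _~sw_ : TV l r → Fin (suc n) → Set
  x ~sw t = Σ (Present S x) λ px → M (tree x px) (switch t)

  partner-unique : ∀ {x} {px px′ : Present S x} {u v} → M (tree x px) u → M (tree x px′) v → u ≡ v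
  partner-unique {px = px} {px′} m m′ rewrite T-irrelevant px px′ = unique m m′

  ~-functional : ∀ {x y y′} → x ~ y → x ~ y′ → y ≡ y′
  ~-functional (_ , _ , m) (_ , _ , m′) with partner-unique m m′
  ... | refl = refl

  ~-sym : ∀ {x y} → x ~ y → y ~ x
  ~-sym (px , py , m) = py , px , M-sym m

  ~-~sw-exclusive : ∀ {x y t} → x ~ y → ¬ x ~sw t
  ~-~sw-exclusive (_ , _ , m) (_ , m′) with partner-unique m m′
  ... | ()

  ~sw-functional : ∀ {x t t′} → x ~sw t → x ~sw t′ → t ≡ t′
  ~sw-functional (_ , m) (_ , m′) with partner-unique m m′
  ... | refl = refl

  ~sw-injective : ∀ {x x′ t} → x ~sw t → x′ ~sw t → x ≡ x′
  ~sw-injective (_ , m) (_ , m′) with unique (M-sym m) (M-sym m′)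
  ... | refl = refl

  switch-site : ∀ t → Σ (TV l r) λ x → x ~sw t × label x ≡ just (switchLabels is I t)
  switch-site t with partner (switch t)
  ... | _ , m with M⊆Adj m
  ... | inj₁ (switch-edge {pv = px} eq) = _ , (px , M-sym m) , eq

  ~sw-label : ∀ {x t} → x ~sw t → label x ≡ just (switchLabels is I t)
  ~sw-label {t = t} m with switch-site t
  ... | _ , m′ , eq with ~sw-injective m m′
  ... | refl = eq

  w~sI : w ~sw sI
  w~sI with switch-site sI
  ... | x , m , eq with label-injective x w l≤r (trans eq (cong just (switchLabels-sI is I))) label-w
  ... | refl = m

  ~sI⇒w : ∀ {x} → x ~sw sI → x ≡ w
  ~sI⇒w m = ~sw-injective m w~sI

  ~s[]-label : ∀ {x t} → x ~sw s[ t ] → label x ≡ just (is t , is t)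
  ~s[]-label {t = t} m = trans (~sw-label m) (cong just (switchLabels-s[] is I t))

  leaf~s[] : ∀ {x t} → label x ≡ just (is t , is t) → x ~sw s[ t ]
  leaf~s[] {x} {t} eq with switch-site s[ t ]
  ... | x′ , m , eq′ with label-injective x′ x l≤r (trans eq′ (cong just (switchLabels-s[] is I t))) eq
  ... | refl = m

  S-is : ∀ t → S (is t) ≡ false
  S-is t with switch-site s[ t ]
  ... | x , m@(px , _) , _ = present-leaf⁻ S x (~s[]-label m) px

  is-injective : Injective _≡_ _≡_ is
  is-injective {t} {t′} eq with switch-site s[ t ] | switch-site s[ t′ ]
  ... | x , m , _ | x′ , m′ , _
    with label-injective x x′ l≤r (trans (~s[]-label m) (cong (λ i → just (i , i)) eq)) (~s[]-label m′)
  ... | refl = punchIn-injective (fromℕ n) t t′ (~sw-functional m m′)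

  Free : ℕ → Set
  Free x = S x ≡ false × (∀ t → x ≢ is t)

  Within : ∀ {a b} → Ctx l r a b → TV l r → Set
  Within {a} {b} c x = Σ (TV a b) λ v → plug c v ≡ x

  label-within : ∀ {a b} (c : Ctx l r a b) {v : TV a b} → plug c v ≡ w → label v ≡ just I
  label-within c {v} refl = trans (sym (label-plug c v)) label-w

  Up : ∀ {a b} → Ctx l r a b → Set
  Up c = Σ (TV l r) λ y → ParentHub c y × plug c root ~ y

  root-partner : ∀ {a b} (c : Ctx l r a b) → Present S (plug c root) →
                 (Σ (a < b) λ a<b → plug c root ~ plug c (hub a<b)) ⊎ Up c ⊎ (∃ λ t → plug c root ~sw t)
  root-partner c pu with partner (tree (plug c root) pu)
  ... | _ , m with M⊆Adj m
  ... | inj₁ (tree-edge {pv = py} e) with edge-from-plug c e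
  ... | _ , refl , root-hub a<b = inj₁ (<-recompute a<b , pu , py , m)
  root-partner c pu | _ , m | inj₂ (tree-edge {pu = py} e) with edge-into-plug c e
  ... | inj₂ (_ , ph) = inj₂ (inj₁ (_ , ph , pu , py , m))
  root-partner c pu | _ , m | inj₂ (switch-edge _) = inj₂ (inj₂ (_ , pu , m))

  hub-partner : ∀ {a b} (c : Ctx l r a b) .(a<b : a < b) →
                plug c (hub a<b) ~ plug c root ⊎ plug c (hub a<b) ~ plug c (left a<b root)
                  ⊎ plug c (hub a<b) ~ plug c (right a<b root)
  hub-partner c a<b with partner (tree (plug c (hub a<b)) (present-unlabelled S (plug c (hub a<b)) (label-plug c (hub a<b))))
  ... | _ , m with M⊆Adj m
  ... | inj₁ (tree-edge {pu = ph} {pv = py} e) with edge-from-plug c e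
  ... | _ , refl , hub-left _  = inj₂ (inj₁ (ph , py , m))
  ... | _ , refl , hub-right _ = inj₂ (inj₂ (ph , py , m))
  hub-partner c a<b | _ , m | inj₂ (tree-edge {pu = py} {pv = ph} e) with edge-into-plug c e
  ... | inj₁ (_ , refl , root-hub _) = inj₁ (ph , py , m)
  hub-partner c a<b | _ , m | inj₂ (switch-edge eq) with trans (sym (label-plug c (hub a<b))) eq
  ... | ()

  hub~root : ∀ {a b} (c : Ctx l r a b) (a<b : a < b) → ¬ Up c → plug c root ≢ w → plug c (hub a<b) ~ plug c root
  hub~root c a<b ¬up u≢w
    with root-partner c (present-by-label S (plug c root) (label-plug c root) λ a≡b → ⊥-elim (<-irrefl a≡b a<b))
  ... | inj₁ (_ , m)       = ~-sym m
  ... | inj₂ (inj₁ up)     = ⊥-elim (¬up up)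
  ... | inj₂ (inj₂ (t , m)) with snocView t
  ... | last  = ⊥-elim (u≢w (~sI⇒w m))
  ... | old t′ with trans (sym (label-plug c root)) (~s[]-label m)
  ... | refl = ⊥-elim (<-irrefl refl a<b)

  data Status {a b} (c : Ctx l r a b) : Set where
    carrying : Within c w → ¬ Up c → Status c
    raised   : ¬ Within c w → Up c → Status c
    idle     : ¬ Within c w → ¬ Up c → Status c

  FreeLeaves : ∀ {a b} {c : Ctx l r a b} → Status c → Set
  FreeLeaves {a} {b} (carrying _ _) = Σ (UniqueIn Free (a , b)) λ u → proj₁ u ∈I I
  FreeLeaves {a} {b} (raised _ _)   = UniqueIn Free (a , b)
  FreeLeaves {a} {b} (idle _ _)     = NoneIn Free (a , b)

  unswitched-leaf-free : ∀ {a} {x : TV l r} → label x ≡ just (a , a) → Present S x →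
                         (∀ t → ¬ x ~sw s[ t ]) → Free a
  unswitched-leaf-free {x = x} eq px unswitched =
    present-leaf⁻ S x eq px , λ { t refl → unswitched t (leaf~s[] eq) }

  only-free-leaf : ∀ {a} → Free a → UniqueIn Free (a , a)
  only-free-leaf free = _ , (≤-refl , ≤-refl) , free , λ _ (a≤x , x≤a) _ → ≤-antisym x≤a a≤x

  leaf-free-leaves : ∀ {a} (c : Ctx l r a a) (s : Status c) → FreeLeaves s
  leaf-free-leaves c (carrying (root , u≡w) _) =
    only-free-leaf (unswitched-leaf-free (label-plug c root) (proj₁ u~sI) λ t m → punchInᵢ≢i _ t (sym (~sw-functional u~sI m))) ,
    subst (_ ∈I_) (just-injective (label-within c u≡w)) (≤-refl , ≤-refl)
    where u~sI = subst (_~sw sI) (sym u≡w) w~sI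
  leaf-free-leaves c (carrying (hub a<a , _) _)     = ⊥-elim (<-irrefl refl (<-recompute a<a))
  leaf-free-leaves c (carrying (left a<a _ , _) _)  = ⊥-elim (<-irrefl refl (<-recompute a<a))
  leaf-free-leaves c (carrying (right a<a _ , _) _) = ⊥-elim (<-irrefl refl (<-recompute a<a))
  leaf-free-leaves c (raised _ (_ , _ , m)) =
    only-free-leaf (unswitched-leaf-free (label-plug c root) (proj₁ m) λ t → ~-~sw-exclusive m)
  leaf-free-leaves c (idle ¬within ¬up) x (a≤x , x≤a) (S-x , x∉is) rewrite ≤-antisym x≤a a≤x
    with root-partner c (present-by-label S (plug c root) (label-plug c root) λ _ → S-x)
  ... | inj₁ (a<a , _)     = <-irrefl refl a<a
  ... | inj₂ (inj₁ up)     = ¬up up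
  ... | inj₂ (inj₂ (t , m)) with snocView t
  ... | last   = ¬within (root , ~sI⇒w m)
  ... | old t′ with trans (sym (label-plug c root)) (~s[]-label m)
  ... | refl = x∉is t′ refl

  module _ {a b} (c : Ctx l r a b) (a<b : a < b) where

    private
      h = plug c (hub a<b)

    plug-≢ : ∀ {v v′ : TV a b} → v ≢ v′ → plug c v ≢ plug c v′
    plug-≢ v≢v′ eq = v≢v′ (plug-injective c eq)

    up-inL : h ~ plug c (left a<b root) → Up (inL c a<b)
    up-inL m = h , refl , ~-sym m

    up-inR : h ~ plug c (right a<b root) → Up (inR c a<b)
    up-inR m = h , refl , ~-sym m

    ¬up-inL : ∀ {x} → h ~ x → x ≢ plug c (left a<b root) → ¬ Up (inL c a<b)
    ¬up-inL m x≢uL (_ , refl , m′) = x≢uL (~-functional m (~-sym m′))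

    ¬up-inR : ∀ {x} → h ~ x → x ≢ plug c (right a<b root) → ¬ Up (inR c a<b)
    ¬up-inR m x≢uR (_ , refl , m′) = x≢uR (~-functional m (~-sym m′))

    ¬within-inL : ¬ Within c w → ¬ Within (inL c a<b) w
    ¬within-inL ¬within (v , e) = ¬within (left a<b v , e)

    ¬within-inR : ¬ Within c w → ¬ Within (inR c a<b) w
    ¬within-inR ¬within (v , e) = ¬within (right a<b v , e)

    ¬within-inL-beside : ∀ {v} → plug c v ≡ w → (∀ {v′} → left a<b v′ ≢ v) → ¬ Within (inL c a<b) w
    ¬within-inL-beside e apart (_ , e′) = apart (plug-injective c (trans e′ (sym e)))

    ¬within-inR-beside : ∀ {v} → plug c v ≡ w → (∀ {v′} → right a<b v′ ≢ v) → ¬ Within (inR c a<b) w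
    ¬within-inR-beside e apart (_ , e′) = apart (plug-injective c (trans e′ (sym e)))

    in-I : plug c root ≡ w → UniqueIn Free (a , b) → Σ (UniqueIn Free (a , b)) λ u → proj₁ u ∈I I
    in-I u≡w u@(_ , i∈ , _) = u , subst (_ ∈I_) (just-injective (label-within c u≡w)) i∈

    join₁ : UniqueIn Free (a , mid a b) → NoneIn Free (suc (mid a b) , b) → UniqueIn Free (a , b)
    join₁ = uniqueIn-++-noneIn (<⇒≤ (m<n⇒mid<n a<b))

    join₂ : NoneIn Free (a , mid a b) → UniqueIn Free (suc (mid a b) , b) → UniqueIn Free (a , b)
    join₂ = noneIn-++-uniqueIn (m<n⇒m≤mid a<b)

    node-free-leaves : (∀ s → FreeLeaves {c = inL c a<b} s) → (∀ s → FreeLeaves {c = inR c a<b} s) →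
                       ∀ s → FreeLeaves {c = c} s
    node-free-leaves lower upper (carrying (root , u≡w) _) with hub-partner c a<b
    ... | inj₁ h~u = ⊥-elim (~-~sw-exclusive (~-sym h~u) (subst (_~sw sI) (sym u≡w) w~sI))
    ... | inj₂ (inj₁ h~uL) = in-I u≡w (join₁ (lower (raised (¬within-inL-beside u≡w λ ()) (up-inL h~uL)))
                                        (upper (idle (¬within-inR-beside u≡w λ ()) (¬up-inR h~uL (plug-≢ λ ())))))
    ... | inj₂ (inj₂ h~uR) = in-I u≡w (join₂ (lower (idle (¬within-inL-beside u≡w λ ()) (¬up-inL h~uR (plug-≢ λ ()))))
                                        (upper (raised (¬within-inR-beside u≡w λ ()) (up-inR h~uR))))
    node-free-leaves lower upper (carrying (hub _ , e) _) with label-within c e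
    ... | ()
    node-free-leaves lower upper (carrying (left _ v , e) ¬up) =
      join₁ (proj₁ inner) (upper (idle (¬within-inR-beside e λ ()) (¬up-inR h~u (plug-≢ λ ())))) , proj₂ inner
      where
      h~u = hub~root c a<b ¬up λ u≡w → plug-≢ (λ ()) (trans u≡w (sym e))
      inner = lower (carrying (v , e) (¬up-inL h~u (plug-≢ λ ())))
    node-free-leaves lower upper (carrying (right _ v , e) ¬up) =
      join₂ (lower (idle (¬within-inL-beside e λ ()) (¬up-inL h~u (plug-≢ λ ())))) (proj₁ inner) , proj₂ inner
      where
      h~u = hub~root c a<b ¬up λ u≡w → plug-≢ (λ ()) (trans u≡w (sym e))
      inner = upper (carrying (v , e) (¬up-inR h~u (plug-≢ λ ())))
    node-free-leaves lower upper (raised ¬within (_ , ph , m)) with hub-partner c a<b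
    ... | inj₁ h~u = ⊥-elim (parentHub-outside c ph (hub a<b) (~-functional m (~-sym h~u)))
    ... | inj₂ (inj₁ h~uL) = join₁ (lower (raised (¬within-inL ¬within) (up-inL h~uL)))
                                   (upper (idle (¬within-inR ¬within) (¬up-inR h~uL (plug-≢ λ ()))))
    ... | inj₂ (inj₂ h~uR) = join₂ (lower (idle (¬within-inL ¬within) (¬up-inL h~uR (plug-≢ λ ()))))
                                   (upper (raised (¬within-inR ¬within) (up-inR h~uR)))
    node-free-leaves lower upper (idle ¬within ¬up) =
      noneIn-++ (lower (idle (¬within-inL ¬within) (¬up-inL h~u (plug-≢ λ ()))))
                (upper (idle (¬within-inR ¬within) (¬up-inR h~u (plug-≢ λ ()))))
      where h~u = hub~root c a<b ¬up λ u≡w → ¬within (root , u≡w)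

  free-leaves : ∀ {a b} (c : Ctx l r a b) → Bisection a b → (s : Status c) → FreeLeaves s
  free-leaves c leaf             = leaf-free-leaves c
  free-leaves c (node a<b lo hi) = node-free-leaves c a<b (free-leaves (inL c a<b) lo) (free-leaves (inR c a<b) hi)

  unique-free-leaf : Σ (UniqueIn Free (l , r)) λ u → proj₁ u ∈I I
  unique-free-leaf = free-leaves top (bisection l≤r) (carrying (w , refl) λ ())

  surviving-leaf : (∀ x → S x ≡ true → l ≤ x × x ≤ r) →
            ∃ λ i′ → i′ ∈I I × Injective _≡_ _≡_ (snoc is i′)
                   × (∀ x → (S x ≡ true) ⇔ (l ≤ x × x ≤ r × (∀ t → x ≢ snoc is i′ t)))
  surviving-leaf S-range with unique-free-leaf
  ... | (i′ , _ , (S-i′ , i′∉is) , unique) , i′∈I =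
    i′ , i′∈I , snoc-injective is i′ is-injective (λ t eq → i′∉is t (sym eq)) ,
    λ x → mk⇔ (removed⇒outside x) (outside⇒removed x)
    where
    removed⇒outside : ∀ x → S x ≡ true → l ≤ x × x ≤ r × (∀ t → x ≢ snoc is i′ t)
    removed⇒outside x S-x = proj₁ (S-range x S-x) , proj₂ (S-range x S-x) ,
      avoids-snoc is i′ (λ t → true-false-apart S S-x (S-is t)) (true-false-apart S S-x S-i′)

    outside⇒removed : ∀ x → l ≤ x × x ≤ r × (∀ t → x ≢ snoc is i′ t) → S x ≡ true
    outside⇒removed x (l≤x , x≤r , x∉) with S x in S-x
    ... | true  = refl
    ... | false = ⊥-elim (proj₂ (avoids-snoc⁻ is i′ x∉) (unique x (l≤x , x≤r) (S-x , proj₁ (avoids-snoc⁻ is i′ x∉))))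

module Backward {l r : ℕ} (l≤r : l ≤ r) {n : ℕ} (is : Fin n → ℕ) (is-range : ∀ t → is t ∈I (l , r))
                {i₁ i₂ : ℕ} (w : TV l r) (label-w : label w ≡ just (i₁ , i₂)) (S : ℕ → Bool)
                {i′ : ℕ} (i′∈I : i′ ∈I (i₁ , i₂)) (snoc-inj : Injective _≡_ _≡_ (snoc is i′))
                (removed⇔ : ∀ x → (S x ≡ true) ⇔ (l ≤ x × x ≤ r × (∀ t → x ≢ snoc is i′ t))) where

  is-injective : Injective _≡_ _≡_ is
  is-injective = proj₁ (snoc-injective⁻ is i′ snoc-inj)

  is≢i′ : ∀ t → is t ≢ i′
  is≢i′ = proj₂ (snoc-injective⁻ is i′ snoc-inj)

  S-snoc : ∀ t → S (snoc is i′ t) ≡ false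
  S-snoc t with S (snoc is i′ t) in S-t
  ... | false = refl
  ... | true  = ⊥-elim (proj₂ (proj₂ (Equivalence.to (removed⇔ _) S-t)) t refl)

  S-is : ∀ t → S (is t) ≡ false
  S-is t = trans (cong S (sym (snoc-old is i′ t))) (S-snoc s[ t ])

  S-i′ : S i′ ≡ false
  S-i′ = trans (cong S (sym (snoc-last is i′))) (S-snoc sI)

  S-rest : ∀ x → x ∈I (l , r) → (∀ t → x ≢ is t) → x ≢ i′ → S x ≡ true
  S-rest x (l≤x , x≤r) x∉is x≢i′ = Equivalence.from (removed⇔ x) (l≤x , x≤r , avoids-snoc is i′ x∉is x≢i′)

  data Target (a b : ℕ) : Set where
    vertex    : TV a b → Target a b
    parentHub : Target a b
    switchTo  : Fin (suc n) → Target a b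

  vertex-injective : ∀ {a b} {x y : TV a b} → vertex x ≡ vertex y → x ≡ y
  vertex-injective refl = refl

  liftL : ∀ {a b} .(a<b : a < b) → Target a (mid a b) → Target a b
  liftL a<b (vertex x)   = vertex (left a<b x)
  liftL a<b parentHub    = vertex (hub a<b)
  liftL a<b (switchTo t) = switchTo t

  liftR : ∀ {a b} .(a<b : a < b) → Target (suc (mid a b)) b → Target a b
  liftR a<b (vertex x)   = vertex (right a<b x)
  liftR a<b parentHub    = vertex (hub a<b)
  liftR a<b (switchTo t) = switchTo t

  data Mark : ℕ → ℕ → Set where
    atW   : PathTo i′ i₁ i₂ → Mark i₁ i₂
    markL : ∀ {a b} → .(a < b) → Mark a (mid a b) → Mark a b
    markR : ∀ {a b} → .(a < b) → Mark (suc (mid a b)) b → Mark a b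

  -- closed: the subtree avoids i′; roots are matched with their hubs, kept leaves with their switches.
  -- marked: the subtree contains w, located by the Mark, which goes on as the path from w to i′.
  -- belowW: the subtree lies under w on the path to i′; its root is matched with the hub above it.
  data Mode (a b : ℕ) : Set where
    closed : Mode a b
    marked : Mark a b → Mode a b
    belowW : PathTo i′ a b → Mode a b

  switched? : ∀ a b → Dec (∃ λ t → (is t , is t) ≡ (a , b))
  switched? a b = any? λ t → ≡-dec _≟_ _≟_ (is t , is t) (a , b)

  closedRoot : ∀ a b → Target a b
  closedRoot a b with a <? b
  ... | yes a<b = vertex (hub a<b)
  ... | no _ with switched? a b
  ... | yes (t , _) = switchTo s[ t ]
  ... | no _        = parentHub  -- junk: such a leaf is removed (closedRoot-kept-leaf)

  toward : ∀ {a b} → PathTo i′ a b → .(a < b) → Target a b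
  toward here        a<a = ⊥-elim (<-irrefl refl (<-recompute a<a))
  toward (goL a<b _) _   = vertex (left a<b root)
  toward (goR a<b _) _   = vertex (right a<b root)

  towardL : ∀ {a b} → PathTo i′ a b → .(a < b) → Mode a (mid a b)
  towardL here        a<a = ⊥-elim (<-irrefl refl (<-recompute a<a))
  towardL (goL _ d) _     = belowW d
  towardL (goR _ _) _     = closed

  towardR : ∀ {a b} → PathTo i′ a b → .(a < b) → Mode (suc (mid a b)) b
  towardR here        a<a = ⊥-elim (<-irrefl refl (<-recompute a<a))
  towardR (goL _ _) _     = closed
  towardR (goR _ d) _     = belowW d

  rootMate : ∀ {a b} → Mode a b → Target a b
  rootMate {a} {b} closed   = closedRoot a b
  rootMate (marked (atW _))     = switchTo sI
  rootMate (marked (markL a<b _)) = vertex (hub a<b)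
  rootMate (marked (markR a<b _)) = vertex (hub a<b)
  rootMate (belowW _)       = parentHub

  hubMate : ∀ {a b} → Mode a b → .(a < b) → Target a b
  hubMate closed               _   = vertex root
  hubMate (marked (atW d))     a<b = toward d a<b
  hubMate (marked (markL _ _)) _   = vertex root
  hubMate (marked (markR _ _)) _   = vertex root
  hubMate (belowW d)           a<b = toward d a<b

  lowerMode : ∀ {a b} → Mode a b → .(a < b) → Mode a (mid a b)
  lowerMode closed               _   = closed
  lowerMode (marked (atW d))     a<b = towardL d a<b
  lowerMode (marked (markL _ k)) _   = marked k
  lowerMode (marked (markR _ _)) _   = closed
  lowerMode (belowW d)           a<b = towardL d a<b

  upperMode : ∀ {a b} → Mode a b → .(a < b) → Mode (suc (mid a b)) b
  upperMode closed               _   = closed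
  upperMode (marked (atW d))     a<b = towardR d a<b
  upperMode (marked (markL _ _)) _   = closed
  upperMode (marked (markR _ k)) _   = marked k
  upperMode (belowW d)           a<b = towardR d a<b

  mate : ∀ {a b} → Mode a b → TV a b → Target a b
  mate m root          = rootMate m
  mate m (hub a<b)     = hubMate m a<b
  mate m (left a<b v)  = liftL a<b (mate (lowerMode m a<b) v)
  mate m (right a<b v) = liftR a<b (mate (upperMode m a<b) v)

  data Below {a b} : Mode a b → Set where
    below : (d : PathTo i′ a b) → Below (belowW d)

  Subinterval : ℕ → ℕ → Set
  Subinterval a b = l ≤ a × a ≤ b × b ≤ r

  subinterval-lower : ∀ {a b} → Subinterval a b → .(a < b) → Subinterval a (mid a b)
  subinterval-lower (l≤a , _ , b≤r) a<b =
    l≤a , m<n⇒m≤mid (<-recompute a<b) , ≤-trans (<⇒≤ (m<n⇒mid<n (<-recompute a<b))) b≤r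

  subinterval-upper : ∀ {a b} → Subinterval a b → .(a < b) → Subinterval (suc (mid a b)) b
  subinterval-upper (l≤a , _ , b≤r) a<b =
    ≤-trans l≤a (≤-trans (m<n⇒m≤mid (<-recompute a<b)) (n≤1+n _)) , m<n⇒mid<n (<-recompute a<b) , b≤r

  Valid : ∀ {a b} → Mode a b → Set
  Valid {a} {b} closed = i′ < a ⊎ b < i′
  Valid (marked _)     = ⊤
  Valid (belowW _)     = ⊤

  mark-bounds : ∀ {a b} → Mark a b → i′ ∈I (a , b)
  mark-bounds (atW d)       = pathTo-bounds d
  mark-bounds (markL a<b k) with mark-bounds k
  ... | a≤i′ , i′≤m = a≤i′ , ≤-trans i′≤m (<⇒≤ (m<n⇒mid<n (<-recompute a<b)))
  mark-bounds (markR a<b k) with mark-bounds k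
  ... | m<i′ , i′≤b = ≤-trans (m<n⇒m≤mid (<-recompute a<b)) (<⇒≤ m<i′) , i′≤b

  towardL-valid : ∀ {a b} (d : PathTo i′ a b) .(a<b : a < b) → Valid (towardL d a<b)
  towardL-valid here      a<a = ⊥-elim (<-irrefl refl (<-recompute a<a))
  towardL-valid (goL _ _) _   = _
  towardL-valid (goR _ d) _   = inj₂ (proj₁ (pathTo-bounds d))

  towardR-valid : ∀ {a b} (d : PathTo i′ a b) .(a<b : a < b) → Valid (towardR d a<b)
  towardR-valid here      a<a = ⊥-elim (<-irrefl refl (<-recompute a<a))
  towardR-valid (goL _ d) _   = inj₁ (s≤s (proj₂ (pathTo-bounds d)))
  towardR-valid (goR _ _) _   = _

  lowerMode-valid : ∀ {a b} (m : Mode a b) .(a<b : a < b) → Valid m → Valid (lowerMode m a<b)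
  lowerMode-valid closed a<b (inj₁ i′<a) = inj₁ i′<a
  lowerMode-valid closed a<b (inj₂ b<i′) = inj₂ (<-trans (m<n⇒mid<n (<-recompute a<b)) b<i′)
  lowerMode-valid (marked (atW d))     a<b _ = towardL-valid d a<b
  lowerMode-valid (marked (markL _ _)) _   _ = _
  lowerMode-valid (marked (markR _ k)) _   _ = inj₂ (proj₁ (mark-bounds k))
  lowerMode-valid (belowW d)           a<b _ = towardL-valid d a<b

  upperMode-valid : ∀ {a b} (m : Mode a b) .(a<b : a < b) → Valid m → Valid (upperMode m a<b)
  upperMode-valid closed a<b (inj₁ i′<a) = inj₁ (<-≤-trans i′<a (≤-trans (m<n⇒m≤mid (<-recompute a<b)) (n≤1+n _)))
  upperMode-valid closed a<b (inj₂ b<i′) = inj₂ b<i′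
  upperMode-valid (marked (atW d))     a<b _ = towardR-valid d a<b
  upperMode-valid (marked (markL _ k)) _   _ = inj₁ (s≤s (proj₂ (mark-bounds k)))
  upperMode-valid (marked (markR _ _)) _   _ = _
  upperMode-valid (belowW d)           a<b _ = towardR-valid d a<b

  present-∋i′ : ∀ {a b x y} (v : TV a b) → label v ≡ just (x , y) → i′ ∈I (x , y) → Present S v
  present-∋i′ v eq (x≤i′ , i′≤y) =
    present-by-label S v eq λ { refl → subst (λ z → S z ≡ false) (≤-antisym i′≤y x≤i′) S-i′ }

  below-root-present : ∀ {a b} {m : Mode a b} → Below m → Present S (root {a} {b})
  below-root-present (below d) = present-∋i′ root refl (pathTo-bounds d)

  closedRoot-internal : ∀ {a b} (a<b : a < b) → closedRoot a b ≡ vertex (hub a<b)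
  closedRoot-internal {a} {b} a<b with a <? b
  ... | yes _   = refl
  ... | no a≮b = ⊥-elim (a≮b a<b)

  closedRoot-vertex : ∀ {a b x} → closedRoot a b ≡ vertex x → Σ (a < b) λ a<b → x ≡ hub a<b
  closedRoot-vertex {a} {b} eq with a <? b
  closedRoot-vertex refl | yes a<b = a<b , refl
  ... | no _ with switched? a b
  closedRoot-vertex () | no _ | yes _
  closedRoot-vertex () | no _ | no _

  closedRoot-switch : ∀ {a b t} → closedRoot a b ≡ switchTo t → (a , b) ≡ switchLabels is (i₁ , i₂) t
  closedRoot-switch {a} {b} eq with a <? b
  closedRoot-switch () | yes _
  ... | no _ with switched? a b
  closedRoot-switch refl | no _ | yes (t , eq) = trans (sym eq) (sym (switchLabels-s[] is _ t))
  closedRoot-switch ()   | no _ | no _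

  closedRoot-leaf : ∀ t → closedRoot (is t) (is t) ≡ switchTo s[ t ]
  closedRoot-leaf t with is t <? is t
  ... | yes t<t = ⊥-elim (<-irrefl refl t<t)
  ... | no _ with switched? (is t) (is t)
  ... | yes (t′ , eq) = cong (switchTo ∘ s[_]) (is-injective (cong proj₁ eq))
  ... | no unswitched = ⊥-elim (unswitched (t , refl))

  outside⇒≢i′ : ∀ {a} → i′ < a ⊎ a < i′ → a ≢ i′
  outside⇒≢i′ i′∉ refl = [ <-irrefl refl , <-irrefl refl ]′ i′∉

  closedRoot-kept-leaf : ∀ {a b} → Subinterval a b → (i′ < a ⊎ b < i′) → Present S (root {a} {b}) →
                         closedRoot a b ≢ parentHub
  closedRoot-kept-leaf {a} {b} sub i′∉ present eq with a <? b
  closedRoot-kept-leaf sub i′∉ present () | yes _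
  ... | no a≮b with switched? a b
  closedRoot-kept-leaf sub i′∉ present () | no _ | yes _
  closedRoot-kept-leaf {a} (l≤a , a≤b , b≤r) i′∉ present refl | no a≮b | no unswitched
    with ≤-antisym a≤b (≮⇒≥ a≮b)
  ... | refl with trans (sym (S-rest a (l≤a , b≤r) (λ { t refl → unswitched (t , refl) }) (outside⇒≢i′ i′∉)))
                        (present-leaf⁻ S root refl present)
  ... | ()

  rootMate-vertex : ∀ {a b} (m : Mode a b) {x} → rootMate m ≡ vertex x →
                    Σ (a < b) λ a<b → x ≡ hub a<b × hubMate m a<b ≡ vertex root
  rootMate-vertex closed eq with closedRoot-vertex eq
  ... | a<b , refl = a<b , refl , refl
  rootMate-vertex (marked (markL a<b _)) refl = <-recompute a<b , refl , refl
  rootMate-vertex (marked (markR a<b _)) refl = <-recompute a<b , refl , refl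

  rootMate-switch : ∀ {a b} (m : Mode a b) {t} → rootMate m ≡ switchTo t →
                    label (root {a} {b}) ≡ just (switchLabels is (i₁ , i₂) t)
  rootMate-switch closed           eq   = cong just (closedRoot-switch eq)
  rootMate-switch (marked (atW _)) refl = cong just (sym (switchLabels-sI is _))

  rootMate-parentHub : ∀ {a b} (m : Mode a b) → Subinterval a b → Valid m → Present S (root {a} {b}) →
                       rootMate m ≡ parentHub → Below m
  rootMate-parentHub closed     sub i′∉ present eq = ⊥-elim (closedRoot-kept-leaf sub i′∉ present eq)
  rootMate-parentHub (belowW d) _    _   _       _  = below d
  rootMate-parentHub (marked (atW _))     _ _ _ ()
  rootMate-parentHub (marked (markL _ _)) _ _ _ ()
  rootMate-parentHub (marked (markR _ _)) _ _ _ ()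

  rootMate-leaf : ∀ {a b} (m : Mode a b) t → (a , b) ≡ (is t , is t) → rootMate m ≡ switchTo s[ t ]
  rootMate-leaf closed t refl = closedRoot-leaf t
  rootMate-leaf (marked (atW d)) t refl = ⊥-elim (is≢i′ t (≤-antisym (proj₁ (pathTo-bounds d)) (proj₂ (pathTo-bounds d))))
  rootMate-leaf (marked (markL a<a _)) t refl = ⊥-elim (<-irrefl refl (<-recompute a<a))
  rootMate-leaf (marked (markR a<a _)) t refl = ⊥-elim (<-irrefl refl (<-recompute a<a))
  rootMate-leaf (belowW d) t refl = ⊥-elim (is≢i′ t (≤-antisym (proj₁ (pathTo-bounds d)) (proj₂ (pathTo-bounds d))))

  toward-vertex : ∀ {a b} (d : PathTo i′ a b) .(a<b : a < b) →
                    (toward d a<b ≡ vertex (left a<b root) × Below (towardL d a<b))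
                  ⊎ (toward d a<b ≡ vertex (right a<b root) × Below (towardR d a<b))
  toward-vertex here      a<a = ⊥-elim (<-irrefl refl (<-recompute a<a))
  toward-vertex (goL _ d) _   = inj₁ (refl , below d)
  toward-vertex (goR _ d) _   = inj₂ (refl , below d)

  hubMate-vertex : ∀ {a b} (m : Mode a b) .(a<b : a < b) →
                     (hubMate m a<b ≡ vertex root × rootMate m ≡ vertex (hub a<b))
                   ⊎ (hubMate m a<b ≡ vertex (left a<b root) × Below (lowerMode m a<b))
                   ⊎ (hubMate m a<b ≡ vertex (right a<b root) × Below (upperMode m a<b))
  hubMate-vertex closed               a<b = inj₁ (refl , closedRoot-internal (<-recompute a<b))
  hubMate-vertex (marked (atW d))     a<b = inj₂ (toward-vertex d a<b)
  hubMate-vertex (marked (markL _ _)) _   = inj₁ (refl , refl)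
  hubMate-vertex (marked (markR _ _)) _   = inj₁ (refl , refl)
  hubMate-vertex (belowW d)           a<b = inj₂ (toward-vertex d a<b)

  hubMate-is-vertex : ∀ {a b} (m : Mode a b) .(a<b : a < b) → ∃ λ x → hubMate m a<b ≡ vertex x
  hubMate-is-vertex m a<b with hubMate-vertex m a<b
  ... | inj₁ (eq , _)        = _ , eq
  ... | inj₂ (inj₁ (eq , _)) = _ , eq
  ... | inj₂ (inj₂ (eq , _)) = _ , eq

  mate-parentHub : ∀ {a b} (m : Mode a b) (v : TV a b) → mate m v ≡ parentHub → v ≡ root
  mate-parentHub m root _ = refl
  mate-parentHub m (hub a<b) eq with hubMate-is-vertex m a<b
  ... | _ , eq′ with trans (sym eq) eq′
  ... | ()
  mate-parentHub m (left a<b v) eq with mate (lowerMode m a<b) v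
  mate-parentHub m (left a<b v) () | vertex _
  mate-parentHub m (left a<b v) () | parentHub
  mate-parentHub m (left a<b v) () | switchTo _
  mate-parentHub m (right a<b v) eq with mate (upperMode m a<b) v
  mate-parentHub m (right a<b v) () | vertex _
  mate-parentHub m (right a<b v) () | parentHub
  mate-parentHub m (right a<b v) () | switchTo _

  mate-switch : ∀ {a b} (m : Mode a b) (v : TV a b) {t} → mate m v ≡ switchTo t →
                label v ≡ just (switchLabels is (i₁ , i₂) t)
  mate-switch m root eq = rootMate-switch m eq
  mate-switch m (hub a<b) eq with hubMate-is-vertex m a<b
  ... | _ , eq′ with trans (sym eq) eq′
  ... | ()
  mate-switch m (left a<b v) eq with mate (lowerMode m a<b) v in eq′
  mate-switch m (left a<b v) refl | switchTo _ = mate-switch (lowerMode m a<b) v eq′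
  mate-switch m (right a<b v) eq with mate (upperMode m a<b) v in eq′
  mate-switch m (right a<b v) refl | switchTo _ = mate-switch (upperMode m a<b) v eq′

  mate-adjacent : ∀ {a b} (m : Mode a b) (v : TV a b) {x} → mate m v ≡ vertex x → TreeEdge v x ⊎ TreeEdge x v
  mate-adjacent m root eq with rootMate-vertex m eq
  ... | a<b , refl , _ = inj₁ (root-hub a<b)
  mate-adjacent m (hub a<b) eq with hubMate-vertex m a<b
  ... | inj₁ (eq′ , _)        rewrite vertex-injective (trans (sym eq) eq′) = inj₂ (root-hub a<b)
  ... | inj₂ (inj₁ (eq′ , _)) rewrite vertex-injective (trans (sym eq) eq′) = inj₁ (hub-left a<b)
  ... | inj₂ (inj₂ (eq′ , _)) rewrite vertex-injective (trans (sym eq) eq′) = inj₁ (hub-right a<b)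
  mate-adjacent m (left a<b v) eq with mate (lowerMode m a<b) v in eq′
  mate-adjacent m (left a<b v) refl | vertex _ = Sum.map (in-left a<b) (in-left a<b) (mate-adjacent _ v eq′)
  mate-adjacent m (left a<b v) refl | parentHub rewrite mate-parentHub _ v eq′ = inj₂ (hub-left a<b)
  mate-adjacent m (right a<b v) eq with mate (upperMode m a<b) v in eq′
  mate-adjacent m (right a<b v) refl | vertex _ = Sum.map (in-right a<b) (in-right a<b) (mate-adjacent _ v eq′)
  mate-adjacent m (right a<b v) refl | parentHub rewrite mate-parentHub _ v eq′ = inj₂ (hub-right a<b)

  mate-present : ∀ {a b} (m : Mode a b) (v : TV a b) {x} → mate m v ≡ vertex x → Present S x
  mate-present m root eq with rootMate-vertex m eq
  ... | a<b , refl , _ = present-unlabelled S (hub a<b) refl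
  mate-present m (hub a<b) eq with hubMate-vertex m a<b
  ... | inj₁ (eq′ , _)            rewrite vertex-injective (trans (sym eq) eq′) =
    present-by-label S root refl λ a≡b → ⊥-elim (<-irrefl a≡b (<-recompute a<b))
  ... | inj₂ (inj₁ (eq′ , isBelow)) rewrite vertex-injective (trans (sym eq) eq′) =
    present-left S a<b root (below-root-present isBelow)
  ... | inj₂ (inj₂ (eq′ , isBelow)) rewrite vertex-injective (trans (sym eq) eq′) =
    present-right S a<b root (below-root-present isBelow)
  mate-present m (left a<b v) eq with mate (lowerMode m a<b) v in eq′
  mate-present m (left a<b v) refl | vertex x′ = present-left S a<b x′ (mate-present _ v eq′)
  mate-present m (left a<b v) refl | parentHub = present-unlabelled S (hub a<b) refl
  mate-present m (right a<b v) eq with mate (upperMode m a<b) v in eq′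
  mate-present m (right a<b v) refl | vertex x′ = present-right S a<b x′ (mate-present _ v eq′)
  mate-present m (right a<b v) refl | parentHub = present-unlabelled S (hub a<b) refl

  mate-leaf : ∀ {a b} (m : Mode a b) (v : TV a b) t → label v ≡ just (is t , is t) → mate m v ≡ switchTo s[ t ]
  mate-leaf m root          t eq = rootMate-leaf m t (just-injective eq)
  mate-leaf m (left a<b v)  t eq = cong (liftL a<b) (mate-leaf (lowerMode m a<b) v t eq)
  mate-leaf m (right a<b v) t eq = cong (liftR a<b) (mate-leaf (upperMode m a<b) v t eq)

  below-rootMate : ∀ {a b} {m : Mode a b} → Below m → rootMate m ≡ parentHub
  below-rootMate (below _) = refl

  towardL-below : ∀ {a b} (d : PathTo i′ a b) .(a<b : a < b) → Below (towardL d a<b) → toward d a<b ≡ vertex (left a<b root)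
  towardL-below here      a<a _ = ⊥-elim (<-irrefl refl (<-recompute a<a))
  towardL-below (goL _ _) _   _ = refl
  towardL-below (goR _ _) _   ()

  towardR-below : ∀ {a b} (d : PathTo i′ a b) .(a<b : a < b) → Below (towardR d a<b) → toward d a<b ≡ vertex (right a<b root)
  towardR-below here      a<a _ = ⊥-elim (<-irrefl refl (<-recompute a<a))
  towardR-below (goL _ _) _   ()
  towardR-below (goR _ _) _   _ = refl

  lowerMode-below : ∀ {a b} (m : Mode a b) .(a<b : a < b) → Below (lowerMode m a<b) → hubMate m a<b ≡ vertex (left a<b root)
  lowerMode-below (marked (atW d)) a<b = towardL-below d a<b
  lowerMode-below (belowW d)       a<b = towardL-below d a<b
  lowerMode-below closed               _ ()
  lowerMode-below (marked (markL _ _)) _ ()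
  lowerMode-below (marked (markR _ _)) _ ()

  upperMode-below : ∀ {a b} (m : Mode a b) .(a<b : a < b) → Below (upperMode m a<b) → hubMate m a<b ≡ vertex (right a<b root)
  upperMode-below (marked (atW d)) a<b = towardR-below d a<b
  upperMode-below (belowW d)       a<b = towardR-below d a<b
  upperMode-below closed               _ ()
  upperMode-below (marked (markL _ _)) _ ()
  upperMode-below (marked (markR _ _)) _ ()

  mate-involutive : ∀ {a b} (m : Mode a b) (v : TV a b) {x} → Subinterval a b → Valid m → Present S v →
                    mate m v ≡ vertex x → mate m x ≡ vertex v
  mate-involutive m root _ _ _ eq with rootMate-vertex m eq
  ... | _ , refl , hub↦root = hub↦root
  mate-involutive m (hub a<b) _ _ _ eq with hubMate-vertex m a<b
  ... | inj₁ (eq′ , root↦hub)       rewrite vertex-injective (trans (sym eq) eq′) = root↦hub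
  ... | inj₂ (inj₁ (eq′ , isBelow)) rewrite vertex-injective (trans (sym eq) eq′) = cong (liftL a<b) (below-rootMate isBelow)
  ... | inj₂ (inj₂ (eq′ , isBelow)) rewrite vertex-injective (trans (sym eq) eq′) = cong (liftR a<b) (below-rootMate isBelow)
  mate-involutive m (left a<b v) sub valid pv eq with mate (lowerMode m a<b) v in eq′
  ... | vertex x′ with refl ← eq =
    cong (liftL a<b) (mate-involutive _ v (subinterval-lower sub a<b) (lowerMode-valid m a<b valid) (present-left⁻ S a<b v pv) eq′)
  ... | parentHub with refl ← eq | refl ← mate-parentHub _ v eq′ =
    lowerMode-below m a<b
      (rootMate-parentHub _ (subinterval-lower sub a<b) (lowerMode-valid m a<b valid) (present-left⁻ S a<b root pv) eq′)
  mate-involutive m (right a<b v) sub valid pv eq with mate (upperMode m a<b) v in eq′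
  ... | vertex x′ with refl ← eq =
    cong (liftR a<b) (mate-involutive _ v (subinterval-upper sub a<b) (upperMode-valid m a<b valid) (present-right⁻ S a<b v pv) eq′)
  ... | parentHub with refl ← eq | refl ← mate-parentHub _ v eq′ =
    upperMode-below m a<b
      (rootMate-parentHub _ (subinterval-upper sub a<b) (upperMode-valid m a<b valid) (present-right⁻ S a<b root pv) eq′)

  markTo : ∀ {a b} (v : TV a b) → label v ≡ just (i₁ , i₂) → PathTo i′ i₁ i₂ → Mark a b
  markTo root          refl d = atW d
  markTo (left a<b v)  eq   d = markL a<b (markTo v eq d)
  markTo (right a<b v) eq   d = markR a<b (markTo v eq d)

  mate-markTo : ∀ {a b} (v : TV a b) (eq : label v ≡ just (i₁ , i₂)) d → mate (marked (markTo v eq d)) v ≡ switchTo sI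
  mate-markTo root          refl d = refl
  mate-markTo (left a<b v)  eq   d = cong (liftL a<b) (mate-markTo v eq d)
  mate-markTo (right a<b v) eq   d = cong (liftR a<b) (mate-markTo v eq d)

  rootMate-marked≢parentHub : ∀ {a b} (k : Mark a b) → rootMate (marked k) ≢ parentHub
  rootMate-marked≢parentHub (atW _)     ()
  rootMate-marked≢parentHub (markL _ _) ()
  rootMate-marked≢parentHub (markR _ _) ()

  pathToI′ : PathTo i′ i₁ i₂
  pathToI′ = pathTo (bisection (≤-trans (proj₁ i′∈I) (proj₂ i′∈I))) i′∈I

  markW : Mark l r
  markW = markTo w label-w pathToI′

  topMode : Mode l r
  topMode = marked markW

  mate-top≢parentHub : ∀ v → mate topMode v ≢ parentHub
  mate-top≢parentHub v eq with mate-parentHub topMode v eq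
  ... | refl = rootMate-marked≢parentHub markW eq

  V : Set
  V = SV l r (suc n) S

  G : Graph
  G = Tsw l r (suc n) (switchLabels is (i₁ , i₂)) S

  pathToIs : ∀ t → PathTo (is t) l r
  pathToIs t = pathTo (bisection l≤r) (is-range t)

  site : Fin (suc n) → TV l r
  site t with snocView t
  ... | last  = w
  ... | old t′ = endpoint (pathToIs t′)

  label-site : ∀ t → label (site t) ≡ just (switchLabels is (i₁ , i₂) t)
  label-site t with snocView t
  ... | last  = trans label-w (cong just (sym (switchLabels-sI is _)))
  ... | old t′ = trans (label-endpoint (pathToIs t′)) (cong just (sym (switchLabels-s[] is _ t′)))

  present-site : ∀ t → Present S (site t)
  present-site t with snocView t
  ... | last  = present-∋i′ w label-w i′∈I
  ... | old t′ = present-by-label S (endpoint (pathToIs t′)) (label-endpoint (pathToIs t′)) λ _ → S-is t′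

  mate-site : ∀ t → mate topMode (site t) ≡ switchTo t
  mate-site t with snocView t
  ... | last  = mate-markTo w label-w pathToI′
  ... | old t′ = mate-leaf topMode (endpoint (pathToIs t′)) t′ (label-endpoint (pathToIs t′))

  fromTarget : (t : Target l r) → (∀ {x} → t ≡ vertex x → Present S x) → t ≢ parentHub → V
  fromTarget (vertex x)   present _     = tree x (present refl)
  fromTarget parentHub    _       ≢self = ⊥-elim (≢self refl)
  fromTarget (switchTo t) _       _     = switch t

  fromTarget-vertex : ∀ t {present : ∀ {x} → t ≡ vertex x → Present S x} {≢parentHub : t ≢ parentHub}
                      {x} {px : Present S x} →
                      t ≡ vertex x → fromTarget t present ≢parentHub ≡ tree x px
  fromTarget-vertex (vertex x) refl = cong (tree x) (T-irrelevant _ _)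

  fromTarget-switch : ∀ t {present : ∀ {x} → t ≡ vertex x → Present S x} {≢parentHub : t ≢ parentHub} {s} →
                      t ≡ switchTo s → fromTarget t present ≢parentHub ≡ switch s
  fromTarget-switch (switchTo s) refl = refl

  match : V → V
  match (tree v _) = fromTarget (mate topMode v) (mate-present topMode v) (mate-top≢parentHub v)
  match (switch t) = tree (site t) (present-site t)

  match-involutive : ∀ u → match (match u) ≡ u
  match-involutive (tree v pv) = go (mate topMode v) refl
    where
    go : ∀ t → mate topMode v ≡ t → match (match (tree v pv)) ≡ tree v pv
    go (vertex x) eq = trans (cong match (fromTarget-vertex _ {px = mate-present topMode v eq} eq))
      (fromTarget-vertex _ (mate-involutive topMode v (≤-refl , l≤r , ≤-refl) _ pv eq))
    go parentHub eq = ⊥-elim (mate-top≢parentHub v eq)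
    go (switchTo s) eq with label-injective (site s) v l≤r (label-site s) (mate-switch topMode v eq)
    ... | refl = trans (cong match (fromTarget-switch _ eq)) (cong (tree v) (T-irrelevant _ _))
  match-involutive (switch t) = fromTarget-switch _ (mate-site t)

  match-adjacent : ∀ u → Graph.Adj G u (match u)
  match-adjacent (tree v pv) = go (mate topMode v) refl
    where
    go : ∀ t → mate topMode v ≡ t → Graph.Adj G (tree v pv) (match (tree v pv))
    go (vertex x) eq = subst (Graph.Adj G (tree v pv)) (sym (fromTarget-vertex _ {px = mate-present topMode v eq} eq))
      (Sum.map tree-edge tree-edge (mate-adjacent topMode v eq))
    go parentHub eq = ⊥-elim (mate-top≢parentHub v eq)
    go (switchTo s) eq = subst (Graph.Adj G (tree v pv)) (sym (fromTarget-switch _ eq))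
      (inj₂ (switch-edge (mate-switch topMode v eq)))
  match-adjacent (switch t) = inj₁ (switch-edge (label-site t))

  perfectMatching : PerfectMatching G
  perfectMatching = record
    { M       = λ u v → match u ≡ v
    ; M⊆Adj   = λ { {u} refl → match-adjacent u }
    ; M-sym   = λ { {u} refl → match-involutive u }
    ; partner = λ u → match u , refl
    ; unique  = λ eq eq′ → trans (sym eq) eq′
    }

lemma3p7 : (l r : ℕ) → 1 ≤ l → l ≤ r →
           (n : ℕ) (is : Fin n → ℕ) → (∀ t → l ≤ is t × is t ≤ r) →
           (I : Label) → I ∈L[ l , r ] →
           (S : ℕ → Bool) → (∀ i → S i ≡ true → l ≤ i × i ≤ r) →
           PerfectMatching (Tsw l r (suc n) (switchLabels is I) S)
           ⇔ (∃ λ i' → i' ∈I I × Injective _≡_ _≡_ (snoc is i')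
                × (∀ x → (S x ≡ true) ⇔ (l ≤ x × x ≤ r × (∀ t → x ≢ snoc is i' t))))
lemma3p7 l r _ l≤r n is is-range I (w , label-w) S S-range = mk⇔
  (λ PM → Forward.surviving-leaf l≤r is w label-w S PM S-range)
  (λ (_ , i′∈I , snoc-inj , removed⇔) → Backward.perfectMatching l≤r is is-range w label-w S i′∈I snoc-inj removed⇔)
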